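{- Let $A$ be a finite set and $C\subseteq B(A)$ a permutation clone. Then $C$ is borrow closed if and only if for all $f,g\in B(A)$, $f\in C$ and $f\oplus g\in C$ imply $g\in C$.
   Context: $B_n(A)=\mathrm{Sym}(A^n)$, $B(A)=\bigcup_n B_n(A)$. Wire permutations $\pi_\alpha$ ($\alpha\in S_n$) permute coordinates of $A^n$; $i_n$ is the identity of $A^n$; $f\oplus g$ applies $f\in B_n(A)$ to the first $n$ and $g\in B_m(A)$ to the last $m$ coordinates; $f\bullet g$ is composition of permutations after padding the map of smaller arity with identities on extra coordinates. A permutation clone is a subset of $B(A)$ containing all wire permutations and closed under $\oplus$ and $\bullet$. $C$ is borrow closed if for all $f\in B(A)$, $f\oplus i_1\in C$ implies $f\in C$. -}

module Defs where

open import Data.Nat using (ℕ; _+_)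
open import Data.Fin using (Fin)
open import Data.Fin.Permutation using (Permutation′; _⟨$⟩ʳ_)
open import Data.Vec using (Vec; take; drop; _++_; tabulate; lookup)
open import Function using (_∘_; id)
open import Function.Definitions using (Bijective)
open import Relation.Binary.PropositionalEquality using (_≡_; _≗_)

-- The finite set A is Fin k.  A^n is Vec (Fin k) n.
-- An element of B_n(A) = Sym(A^n) is a bijective map A^n → A^n.
Endo : ℕ → ℕ → Set
Endo k n = Vec (Fin k) n → Vec (Fin k) n

IsPerm : ∀ {k n} → Endo k n → Set
IsPerm f = Bijective _≡_ _≡_ f

idn : ∀ {k} n → Endo k n
idn n = id

wire : ∀ {k n} → Permutation′ n → Endo k n
wire α v = tabulate (λ i → lookup v (α ⟨$⟩ʳ i))

_⊕_ : ∀ {k n m} → Endo k n → Endo k m → Endo k (n + m)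
_⊕_ {n = n} f g v = f (take n v) ++ g (drop n v)

-- Subsets of B(A) are predicates on (arity, map) that contain only
-- permutations and are extensional (membership depends only on the map).
-- Closure under • : the map of smaller arity is padded by identities on
-- the extra (last) coordinates, then the two permutations are composed.
record PermClone (k : ℕ) : Set₁ where
  field
    Mem       : ∀ {n} → Endo k n → Set
    ⊆B        : ∀ {n} {f : Endo k n} → Mem f → IsPerm f
    ext       : ∀ {n} {f g : Endo k n} → f ≗ g → Mem f → Mem g
    wires     : ∀ {n} (α : Permutation′ n) → Mem (wire α)
    ⊕-closed  : ∀ {n m} {f : Endo k n} {g : Endo k m} →
                Mem f → Mem g → Mem (f ⊕ g)
    •-closedˡ : ∀ {n j} {f : Endo k n} {g : Endo k (n + j)} →
                Mem f → Mem g → Mem ((f ⊕ idn j) ∘ g)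
    •-closedʳ : ∀ {n j} {f : Endo k (n + j)} {g : Endo k n} →
                Mem f → Mem g → Mem (f ∘ (g ⊕ idn j))

open PermClone public

BorrowClosed : ∀ {k} → PermClone k → Set
BorrowClosed {k} C = ∀ {n} (f : Endo k n) → IsPerm f →
  Mem C (f ⊕ idn 1) → Mem C f

{-# OPTIONS --safe #-}
module Submission where

-- Borrow closure strips one trailing identity wire; conjugating by the wire
-- permutation that swaps two blocks, it equally strips a leading one, so
-- i_n ⊕ g ∈ C gives g ∈ C one wire at a time.  If f ∈ C then, A^n being
-- finite, f^N = id for N = |A^n|! (every orbit has length at most |A^n|), so
-- f⁻¹ = f^(N-1) ∈ C and (f⁻¹ ⊕ i_m) • (f ⊕ g) = i_n ⊕ g ∈ C.  Conversely,
-- f ⊕ i₁ ∈ C swaps to i₁ ⊕ f ∈ C, and cancelling i₁ ∈ C leaves f.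

open import Defs
open import Data.Fin as Fin using (Fin; toℕ; combine; splitAt; join)
open import Data.Fin.Permutation as Perm
  using (Permutation′; _⟨$⟩ʳ_; _⟨$⟩ˡ_; flip; inverseʳ; cast-id)
open import Data.Fin.Properties using (pigeonhole; combine-injective; toℕ<n; +↔⊎)
open import Data.Nat using (ℕ; zero; suc; _+_; _*_; _∸_; _^_; _<_; _≤_; _!; pred; s≤s⁻¹)
open import Data.Nat.Divisibility using (divides; ∣-trans; m∣m*n; m≤n⇒m!∣n!)
open import Data.Nat.GeneralisedArithmetic using (iterate)
open import Data.Nat.Properties
  using (n<1+n; m∸n≤m; m<n⇒0<n∸m; m∸n+n≡m; <⇒≤; ≤-trans; +-comm; +-identityʳ; suc-pred; _!≢0)
open import Data.Product using (_×_; _,_; ∃-syntax)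
open import Data.Sum using (inj₁; inj₂; swap; [_,_]′)
open import Data.Sum.Properties using (swap-↔)
open import Data.Vec using (Vec; []; _∷_; _++_; take; drop; cast; lookup; tabulate)
open import Data.Vec.Properties
  using (take++drop≡id; ++-injective; ++-identityʳ-eqFree; cast-sym; cast-is-id; lookup∘tabulate;
         tabulate∘lookup; tabulate-cong; lookup-splitAt; lookup-cast₁; lookup-++ˡ; lookup-++ʳ)
open import Function using (_∘_; id)
open import Function.Bundles using (_⇔_; mk⇔)
open import Function.Construct.Composition using (_↔-∘_)
open import Function.Construct.Symmetry using (↔-sym)
import Function.Construct.Identity as Identity
open import Function.Consequences.Propositional using (strictlySurjective⇒surjective)
open import Function.Definitions using (Injective; Surjective)
open import Relation.Binary.PropositionalEquality
  using (_≡_; _≗_; refl; sym; trans; cong; cong₂; module ≡-Reasoning)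
open ≡-Reasoning

module _ {A : Set} where

  take-++ : ∀ {m n} (u : Vec A m) (w : Vec A n) → take m (u ++ w) ≡ u
  take-++ []      w = refl
  take-++ (x ∷ u) w = cong (x ∷_) (take-++ u w)

  drop-++ : ∀ {m n} (u : Vec A m) (w : Vec A n) → drop m (u ++ w) ≡ w
  drop-++ []      w = refl
  drop-++ (x ∷ u) w = drop-++ u w

  cast-involutive : ∀ {m n} .(eq : m ≡ n) (u : Vec A m) → cast (sym eq) (cast eq u) ≡ u
  cast-involutive eq u = cast-sym eq refl

  lookup-++-join-swap : ∀ {m n} (w : Vec A m) (u : Vec A n) s →
                        lookup (w ++ u) (join m n (swap s)) ≡ [ lookup u , lookup w ]′ s
  lookup-++-join-swap w u (inj₁ i) = lookup-++ʳ w u i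
  lookup-++-join-swap w u (inj₂ i) = lookup-++ˡ w u i

module _ {A : Set} {f : A → A} where

  iterate-+ : ∀ x m n → iterate f x (m + n) ≡ iterate f (iterate f x m) n
  iterate-+ x zero    n = refl
  iterate-+ x (suc m) n = iterate-+ (f x) m n

  iterate-injective : Injective _≡_ _≡_ f → ∀ n → Injective _≡_ _≡_ (λ x → iterate f x n)
  iterate-injective f-inj zero    eq = eq
  iterate-injective f-inj (suc n) eq = f-inj (iterate-injective f-inj n eq)

  iterate-periodic : ∀ {x d} → iterate f x d ≡ x → ∀ q → iterate f x (q * d) ≡ x
  iterate-periodic         fixed zero    = refl
  iterate-periodic {x} {d} fixed (suc q) = begin
    iterate f x (d + q * d)            ≡⟨ iterate-+ x d (q * d) ⟩
    iterate f (iterate f x d) (q * d)  ≡⟨ cong (λ y → iterate f y (q * d)) fixed ⟩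
    iterate f x (q * d)                ≡⟨ iterate-periodic fixed q ⟩
    x                                  ∎

module _ {A : Set} {K : ℕ} {encode : A → Fin K} (encode-injective : Injective _≡_ _≡_ encode)
         {f : A → A} (f-injective : Injective _≡_ _≡_ f) where

  bounded-period : ∀ x → ∃[ d ] 0 < d × d ≤ K × iterate f x d ≡ x
  bounded-period x
    with i , j , i<j , same-code ← pigeonhole (n<1+n K) (λ i → encode (iterate f x (toℕ i))) =
    d , m<n⇒0<n∸m i<j , ≤-trans (m∸n≤m (toℕ j) (toℕ i)) (s≤s⁻¹ (toℕ<n j)) ,
    iterate-injective f-injective (toℕ i) (begin
      iterate f (iterate f x d) (toℕ i) ≡⟨ iterate-+ x d (toℕ i) ⟨
      iterate f x (d + toℕ i)           ≡⟨ cong (iterate f x) (m∸n+n≡m (<⇒≤ i<j)) ⟩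
      iterate f x (toℕ j)               ≡⟨ encode-injective same-code ⟨
      iterate f x (toℕ i)               ∎)
    where d = toℕ j ∸ toℕ i

  iterate-factorial : ∀ x → iterate f x (K !) ≡ x
  iterate-factorial x with bounded-period x
  ... | suc d , _ , d≤K , returns
    with divides q K!≡q*d ← ∣-trans (m∣m*n {suc d} (d !)) (m≤n⇒m!∣n! d≤K) =
    trans (cong (iterate f x) K!≡q*d) (iterate-periodic returns q)

encodeVec : ∀ {k n} → Vec (Fin k) n → Fin (k ^ n)
encodeVec []       = Fin.zero
encodeVec (x ∷ xs) = combine x (encodeVec xs)

encodeVec-injective : ∀ {k n} → Injective _≡_ _≡_ (encodeVec {k} {n})
encodeVec-injective {x = []}     {[]}     _  = refl
encodeVec-injective {x = x ∷ xs} {y ∷ ys} eq with x≡y , codes≡ ← combine-injective x _ y _ eq =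
  cong₂ _∷_ x≡y (encodeVec-injective codes≡)

⊕-++ : ∀ {k n m} (f : Endo k n) (g : Endo k m) u w → (f ⊕ g) (u ++ w) ≡ f u ++ g w
⊕-++ f g u w = cong₂ (λ u′ w′ → f u′ ++ g w′) (take-++ u w) (drop-++ u w)

⊕-bijective : ∀ {k n m} {f : Endo k n} {g : Endo k m} → IsPerm f → IsPerm g → IsPerm (f ⊕ g)
⊕-bijective {n = n} {f = f} {g} (f-inj , f-surj) (g-inj , g-surj) = injective , surjective
  where
  injective : Injective _≡_ _≡_ (f ⊕ g)
  injective {v} {v′} eq with f≡ , g≡ ← ++-injective (f (take n v)) (f (take n v′)) eq = begin
    v                         ≡⟨ take++drop≡id n v ⟨
    take n v ++ drop n v      ≡⟨ cong₂ _++_ (f-inj f≡) (g-inj g≡) ⟩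
    take n v′ ++ drop n v′    ≡⟨ take++drop≡id n v′ ⟩
    v′                        ∎
  surjective : Surjective _≡_ _≡_ (f ⊕ g)
  surjective = strictlySurjective⇒surjective λ y →
    let u , fu≡ = f-surj (take n y); w , gw≡ = g-surj (drop n y) in
    u ++ w , (begin
      (f ⊕ g) (u ++ w)          ≡⟨ ⊕-++ f g u w ⟩
      f u ++ g w                ≡⟨ cong₂ _++_ (fu≡ refl) (gw≡ refl) ⟩
      take n y ++ drop n y      ≡⟨ take++drop≡id n y ⟩
      y                         ∎)

wire-flip : ∀ {k n} (α : Permutation′ n) (v : Vec (Fin k) n) → wire (flip α) (wire α v) ≡ v
wire-flip α v = begin
  tabulate (λ i → lookup (wire α v) (α ⟨$⟩ˡ i))  ≡⟨ tabulate-cong (λ i → lookup∘tabulate _ (α ⟨$⟩ˡ i)) ⟩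
  tabulate (λ i → lookup v (α ⟨$⟩ʳ (α ⟨$⟩ˡ i)))  ≡⟨ tabulate-cong (λ i → cong (lookup v) (inverseʳ α)) ⟩
  tabulate (lookup v)                             ≡⟨ tabulate∘lookup v ⟩
  v                                               ∎

blockSwap : ∀ m n → Permutation′ (m + n)
blockSwap m n = ↔-sym (+↔⊎ {m} {n}) ↔-∘ (swap-↔ ↔-∘ (+↔⊎ {n} {m} ↔-∘ cast-id (+-comm m n)))

wire-blockSwap : ∀ {k m n} (w : Vec (Fin k) m) (u : Vec (Fin k) n) →
                 wire (blockSwap m n) (w ++ u) ≡ cast (+-comm n m) (u ++ w)
wire-blockSwap {m = m} {n} w u = begin
  tabulate (λ i → lookup (w ++ u) (blockSwap m n ⟨$⟩ʳ i)) ≡⟨ tabulate-cong swapped ⟩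
  tabulate (lookup (cast (+-comm n m) (u ++ w)))          ≡⟨ tabulate∘lookup _ ⟩
  cast (+-comm n m) (u ++ w)                              ∎
  where
  swapped : ∀ i → lookup (w ++ u) (blockSwap m n ⟨$⟩ʳ i) ≡ lookup (cast (+-comm n m) (u ++ w)) i
  swapped i = begin
    lookup (w ++ u) (join m n (swap (splitAt n i′))) ≡⟨ lookup-++-join-swap w u (splitAt n i′) ⟩
    [ lookup u , lookup w ]′ (splitAt n i′)         ≡⟨ lookup-splitAt n u w i′ ⟨
    lookup (u ++ w) i′                               ≡⟨ lookup-cast₁ (+-comm n m) (u ++ w) i ⟨
    lookup (cast (+-comm n m) (u ++ w)) i           ∎
    where i′ = Fin.cast (+-comm m n) i

cast-⊕-idn-0 : ∀ {k n} (f : Endo k n) x →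
               cast (+-identityʳ n) ((f ⊕ idn 0) (cast (sym (+-identityʳ n)) x)) ≡ f x
cast-⊕-idn-0 {n = n} f x = begin
  cast eq ((f ⊕ idn 0) (cast (sym eq) x))
    ≡⟨ cong (cast eq ∘ (f ⊕ idn 0)) (cast-sym eq (++-identityʳ-eqFree x)) ⟩
  cast eq ((f ⊕ idn 0) (x ++ []))
    ≡⟨ cong (cast eq) (⊕-++ f (idn 0) x []) ⟩
  cast eq (f x ++ [])
    ≡⟨ ++-identityʳ-eqFree (f x) ⟩
  f x
    ∎
  where eq = +-identityʳ n

idn-suc-⊕ : ∀ {k n m} (g : Endo k m) → idn (suc n) ⊕ g ≗ idn 1 ⊕ (idn n ⊕ g)
idn-suc-⊕ g (x ∷ v) = refl

module _ {k : ℕ} (C : PermClone k) where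

  Mem-cast : ∀ {a b} (eq : a ≡ b) {h : Endo k a} → Mem C h → Mem C (cast eq ∘ h ∘ cast (sym eq))
  Mem-cast refl {h} = ext C λ v → sym (trans (cast-is-id refl _) (cong h (cast-is-id refl v)))

  Mem-id : ∀ {n} → Mem C {n} id
  Mem-id = ext C tabulate∘lookup (wires C Perm.id)

  Mem-∘ : ∀ {n} {f g : Endo k n} → Mem C f → Mem C g → Mem C (f ∘ g)
  Mem-∘ {n} {f} {g} f∈C g∈C =
    ext C composite (Mem-cast eq (•-closedˡ C f∈C (Mem-cast (sym eq) g∈C)))
    where
    eq = +-identityʳ n
    composite : ∀ v → cast eq ((f ⊕ idn 0) (cast (sym eq) (g (cast eq (cast (sym eq) v))))) ≡ f (g v)
    composite v = trans (cong (cast eq ∘ (f ⊕ idn 0) ∘ cast (sym eq) ∘ g) (cast-involutive (sym eq) v))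
                        (cast-⊕-idn-0 f (g v))

  Mem-iterate : ∀ {n} {f : Endo k n} → Mem C f → ∀ i → Mem C (λ x → iterate f x i)
  Mem-iterate f∈C zero    = Mem-id
  Mem-iterate f∈C (suc i) = Mem-∘ (Mem-iterate f∈C i) f∈C

  Mem-⊕-comm : ∀ {n m} (f : Endo k n) (g : Endo k m) → Mem C (f ⊕ g) → Mem C (g ⊕ f)
  Mem-⊕-comm {n} {m} f g f⊕g∈C =
    ext C swapped (Mem-∘ (wires C (flip σ)) (Mem-∘ (Mem-cast eq f⊕g∈C) (wires C σ)))
    where
    σ = blockSwap m n
    eq = +-comm n m
    swapped : ∀ v → wire (flip σ) (cast eq ((f ⊕ g) (cast (sym eq) (wire σ v)))) ≡ (g ⊕ f) v
    swapped v = begin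
      wire (flip σ) (cast eq ((f ⊕ g) (cast (sym eq) (wire σ v))))
        ≡⟨ cong (wire (flip σ) ∘ cast eq ∘ (f ⊕ g)) unswapped ⟩
      wire (flip σ) (cast eq ((f ⊕ g) (u ++ w)))
        ≡⟨ cong (wire (flip σ) ∘ cast eq) (⊕-++ f g u w) ⟩
      wire (flip σ) (cast eq (f u ++ g w))
        ≡⟨ cong (wire (flip σ)) (wire-blockSwap (g w) (f u)) ⟨
      wire (flip σ) (wire σ (g w ++ f u))
        ≡⟨ wire-flip σ (g w ++ f u) ⟩
      g w ++ f u
        ∎
      where
      w = take m v
      u = drop m v
      unswapped : cast (sym eq) (wire σ v) ≡ u ++ w
      unswapped = begin
        cast (sym eq) (wire σ v)             ≡⟨ cong (cast (sym eq) ∘ wire σ) (take++drop≡id m v) ⟨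
        cast (sym eq) (wire σ (w ++ u))      ≡⟨ cong (cast (sym eq)) (wire-blockSwap w u) ⟩
        cast (sym eq) (cast eq (u ++ w))     ≡⟨ cast-involutive eq (u ++ w) ⟩
        u ++ w                               ∎

  Mem-inverse : ∀ {n} {f : Endo k n} → Mem C f → Injective _≡_ _≡_ f →
                ∃[ f⁻¹ ] Mem C f⁻¹ × (∀ x → f⁻¹ (f x) ≡ x)
  Mem-inverse {n} {f} f∈C f-inj =
    -- iterate is tail-recursive, so iterate f x (suc i) reduces to iterate f (f x) i
    (λ x → iterate f x (pred N)) , Mem-iterate f∈C (pred N) , λ x →
      trans (cong (iterate f x) (suc-pred N {{(k ^ n) !≢0}}))
            (iterate-factorial encodeVec-injective f-inj x)
    where N = (k ^ n) !

  ⊕-Cancellativeˡ : Set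
  ⊕-Cancellativeˡ = ∀ {n m} (f : Endo k n) (g : Endo k m) → IsPerm f → IsPerm g →
                    Mem C f → Mem C (f ⊕ g) → Mem C g

  module _ (borrowClosed : BorrowClosed C) where

    Mem-idn⊕-cancel : ∀ {m} {g : Endo k m} → IsPerm g → ∀ n → Mem C (idn n ⊕ g) → Mem C g
    Mem-idn⊕-cancel g-perm zero    idn⊕g∈C = idn⊕g∈C
    Mem-idn⊕-cancel {g = g} g-perm (suc n) idn⊕g∈C =
      Mem-idn⊕-cancel g-perm n
        (borrowClosed (idn n ⊕ g) (⊕-bijective (Identity.bijective _≡_) g-perm)
          (Mem-⊕-comm (idn 1) (idn n ⊕ g) (ext C (idn-suc-⊕ g) idn⊕g∈C)))

    borrowClosed⇒⊕-cancellativeˡ : ⊕-Cancellativeˡ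
    borrowClosed⇒⊕-cancellativeˡ {n} {m} f g (f-inj , _) g-perm f∈C f⊕g∈C
      with f⁻¹ , f⁻¹∈C , f⁻¹∘f≗id ← Mem-inverse f∈C f-inj =
      Mem-idn⊕-cancel g-perm n (ext C cancelled (•-closedˡ C f⁻¹∈C f⊕g∈C))
      where
      cancelled : ∀ v → (f⁻¹ ⊕ idn m) ((f ⊕ g) v) ≡ (idn n ⊕ g) v
      cancelled v = trans (⊕-++ f⁻¹ (idn m) (f (take n v)) (g (drop n v)))
                          (cong (_++ g (drop n v)) (f⁻¹∘f≗id (take n v)))

  ⊕-cancellativeˡ⇒borrowClosed : ⊕-Cancellativeˡ → BorrowClosed C
  ⊕-cancellativeˡ⇒borrowClosed cancel f f-perm f⊕idn∈C =
    cancel (idn 1) f (Identity.bijective _≡_) f-perm Mem-id (Mem-⊕-comm f (idn 1) f⊕idn∈C)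

lemma2 : (k : ℕ) (C : PermClone k) →
    BorrowClosed C ⇔
      (∀ {n m} (f : Endo k n) (g : Endo k m) → IsPerm f → IsPerm g →
        Mem C f → Mem C (f ⊕ g) → Mem C g)
lemma2 k C = mk⇔ (borrowClosed⇒⊕-cancellativeˡ C) (⊕-cancellativeˡ⇒borrowClosed C)
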